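{- In the theory Glob, for all raw contexts $\Gamma,\Delta$, raw type $A$, raw term $t$ and raw substitution $\gamma$: if $\Gamma\vdash A$ and $\Delta\vdash\gamma:\Gamma$ then $\Delta\vdash A[\gamma]$; and if $\Gamma\vdash t:A$ and $\Delta\vdash\gamma:\Gamma$ then $\Delta\vdash t[\gamma]:A[\gamma]$.
   Context: The meta-theory is Martin-Löf type theory without axiom K; "$=$" is the identity type. Raw syntax of the theory Glob (variables are natural numbers): raw types are $*$ and $\Rightarrow(A,t,u)$ for a raw type $A$ and raw terms $t,u$; raw terms are $\mathrm{Var}\,x$ for $x\in\mathbb{N}$; raw contexts are finite lists of pairs $(x,A)$; raw substitutions are finite lists of pairs $(x,t)$. $\mathrm{nil}$ is the empty list, $L::p$ appends $p$. Action of substitutions: $*[\gamma]=*$, $\Rightarrow(A,t,u)[\gamma]=\Rightarrow(A[\gamma],t[\gamma],u[\gamma])$, $\mathrm{Var}\,x[\mathrm{nil}]=\mathrm{Var}\,x$, $\mathrm{Var}\,x[\gamma::(v,t)]=t$ if $x=v$ and $=\mathrm{Var}\,x[\gamma]$ otherwise. Judgements $\Gamma\vdash$, $\Gamma\vdash A$, $\Gamma\vdash t:A$, $\Delta\vdash\gamma:\Gamma$ are inductive families generated by: (ec) $\mathrm{nil}\vdash$; (cc) from $\Gamma\vdash$, $\Gamma\vdash A$, $x=\mathrm{length}(\Gamma)$ derive $\Gamma::(x,A)\vdash$; (ob) from $\Gamma\vdash$ derive $\Gamma\vdash *$; (ar) from $\Gamma\vdash t:A$, $\Gamma\vdash u:A$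 derive $\Gamma\vdash\Rightarrow(A,t,u)$; (var) from $\Gamma\vdash$ and $(x,A)\in\Gamma$ derive $\Gamma\vdash\mathrm{Var}\,x:A$; (es) from $\Delta\vdash$ derive $\Delta\vdash\mathrm{nil}:\mathrm{nil}$; (sc) from $\Delta\vdash\gamma:\Gamma$, $\Gamma::(x,A)\vdash$, $\Delta\vdash t:A[\gamma]$ and $x=y$ derive $\Delta\vdash\gamma::(y,t):\Gamma::(x,A)$. -}

module Defs where

open import Data.Nat using (ℕ; suc)
open import Data.Nat.Properties using (_≟_)
open import Data.Product using (_×_; _,_)
open import Relation.Nullary using (yes; no)
open import Relation.Binary.PropositionalEquality using (_≡_)

infixl 5 _::_
data SList (X : Set) : Set where
  nil  : SList X
  _::_ : SList X → X → SList X

length : {X : Set} → SList X → ℕ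
length nil = 0
length (L :: _) = suc (length L)

data _∈_ {X : Set} (a : X) : SList X → Set where
  here  : {L : SList X} → a ∈ (L :: a)
  there : {L : SList X} {b : X} → a ∈ L → a ∈ (L :: b)

data Tm : Set where
  Var : ℕ → Tm

data Ty : Set where
  ⋆ : Ty
  ⇒ : Ty → Tm → Tm → Ty

Ctx : Set
Ctx = SList (ℕ × Ty)

Sub : Set
Sub = SList (ℕ × Tm)

_[_]tm : Tm → Sub → Tm
Var x [ nil ]tm = Var x
Var x [ γ :: (v , t) ]tm with x ≟ v
... | yes _ = t
... | no  _ = Var x [ γ ]tm

_[_]ty : Ty → Sub → Ty
⋆ [ γ ]ty = ⋆
⇒ A t u [ γ ]ty = ⇒ (A [ γ ]ty) (t [ γ ]tm) (u [ γ ]tm)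

data _⊢ : Ctx → Set
data _⊢ty_ : Ctx → Ty → Set
data _⊢_∶_ : Ctx → Tm → Ty → Set
data _⊢s_∶_ : Ctx → Sub → Ctx → Set

data _⊢ where
  ec : nil ⊢
  cc : {Γ : Ctx} {A : Ty} {x : ℕ} → Γ ⊢ → Γ ⊢ty A → x ≡ length Γ → (Γ :: (x , A)) ⊢

data _⊢ty_ where
  ob : {Γ : Ctx} → Γ ⊢ → Γ ⊢ty ⋆
  ar : {Γ : Ctx} {A : Ty} {t u : Tm} → Γ ⊢ t ∶ A → Γ ⊢ u ∶ A → Γ ⊢ty ⇒ A t u

data _⊢_∶_ where
  var : {Γ : Ctx} {x : ℕ} {A : Ty} → Γ ⊢ → (x , A) ∈ Γ → Γ ⊢ Var x ∶ A

data _⊢s_∶_ where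
  es : {Δ : Ctx} → Δ ⊢ → Δ ⊢s nil ∶ nil
  sc : {Δ Γ : Ctx} {γ : Sub} {x y : ℕ} {A : Ty} {t : Tm} →
       Δ ⊢s γ ∶ Γ → (Γ :: (x , A)) ⊢ → Δ ⊢ t ∶ (A [ γ ]ty) → x ≡ y →
       Δ ⊢s (γ :: (y , t)) ∶ (Γ :: (x , A))

{-# OPTIONS --safe #-}
-- A derivable context Γ binds exactly the variables 0, …, length Γ − 1, and every
-- type it assigns mentions only variables bound before it. Hence, in Δ ⊢s γ :: (n , t) ∶ Γ :: (n , A),
-- the last binding is invisible to A and to the earlier variables, so the variable
-- rule is preserved by induction on the membership proof; the type and term rules
-- then follow by a structural mutual induction.
module Submission where

open import Defs
open import Data.Nat using (ℕ; _<_; _≤_)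
open import Data.Nat.Properties using (_≟_; <-irrefl; <-≤-trans; n≤1+n; n<1+n)
open import Data.Product using (_×_; _,_; proj₁; proj₂)
open import Relation.Nullary using (yes; no; ¬_)
open import Relation.Binary.PropositionalEquality using (_≡_; refl; subst₂; sym)
open import Data.Empty using (⊥-elim)

data Tm< (n : ℕ) : Tm → Set where
  var< : {x : ℕ} → x < n → Tm< n (Var x)

data Ty< (n : ℕ) : Ty → Set where
  ⋆<  : Ty< n ⋆
  ⇒< : {A : Ty} {t u : Tm} → Ty< n A → Tm< n t → Tm< n u → Ty< n (⇒ A t u)

Tm<-mono : ∀ {m n t} → m ≤ n → Tm< m t → Tm< n t
Tm<-mono m≤n (var< x<m) = var< (<-≤-trans x<m m≤n)

Ty<-mono : ∀ {m n A} → m ≤ n → Ty< m A → Ty< n A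
Ty<-mono m≤n ⋆<          = ⋆<
Ty<-mono m≤n (⇒< A t u) = ⇒< (Ty<-mono m≤n A) (Tm<-mono m≤n t) (Tm<-mono m≤n u)

∈⇒scoped : ∀ {Γ x A} → Γ ⊢ → (x , A) ∈ Γ → x < length Γ × Ty< (length Γ) A
⊢ty⇒Ty< : ∀ {Γ A} → Γ ⊢ty A → Ty< (length Γ) A
⊢tm⇒scoped : ∀ {Γ t A} → Γ ⊢ t ∶ A → Tm< (length Γ) t × Ty< (length Γ) A

∈⇒scoped (cc Γ⊢ Γ⊢A refl) here      = n<1+n _ , Ty<-mono (n≤1+n _) (⊢ty⇒Ty< Γ⊢A)
∈⇒scoped (cc Γ⊢ Γ⊢A refl) (there m) with ∈⇒scoped Γ⊢ m
... | x< , A< = <-≤-trans x< (n≤1+n _) , Ty<-mono (n≤1+n _) A<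

⊢ty⇒Ty< (ob _)   = ⋆<
⊢ty⇒Ty< (ar t u) = ⇒< (proj₂ (⊢tm⇒scoped t)) (proj₁ (⊢tm⇒scoped t)) (proj₁ (⊢tm⇒scoped u))

⊢tm⇒scoped (var Γ⊢ m) with ∈⇒scoped Γ⊢ m
... | x< , A< = var< x< , A<

Var-[]-≡ : ∀ x t γ → Var x [ γ :: (x , t) ]tm ≡ t
Var-[]-≡ x t γ with x ≟ x
... | yes _  = refl
... | no x≢x = ⊥-elim (x≢x refl)

Var-[]-≢ : ∀ {x v} t γ → ¬ (x ≡ v) → Var x [ γ :: (v , t) ]tm ≡ Var x [ γ ]tm
Var-[]-≢ {x} {v} t γ x≢v with x ≟ v
... | yes x≡v = ⊥-elim (x≢v x≡v)
... | no _    = refl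

[]tm-fresh : ∀ {n s} γ t → Tm< n s → s [ γ :: (n , t) ]tm ≡ s [ γ ]tm
[]tm-fresh γ t (var< x<n) = Var-[]-≢ t γ (λ x≡n → <-irrefl x≡n x<n)

[]ty-fresh : ∀ {n A} γ t → Ty< n A → A [ γ :: (n , t) ]ty ≡ A [ γ ]ty
[]ty-fresh γ t ⋆< = refl
[]ty-fresh γ t (⇒< A u v)
  rewrite []ty-fresh γ t A | []tm-fresh γ t u | []tm-fresh γ t v = refl

⊢s⇒⊢ : ∀ {Δ γ Γ} → Δ ⊢s γ ∶ Γ → Δ ⊢
⊢s⇒⊢ (es Δ⊢)          = Δ⊢
⊢s⇒⊢ (sc γ∶Γ _ _ _) = ⊢s⇒⊢ γ∶Γ

var-[] : ∀ {Γ Δ γ x A} → Γ ⊢ → (x , A) ∈ Γ → Δ ⊢s γ ∶ Γ →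
         Δ ⊢ (Var x [ γ ]tm) ∶ (A [ γ ]ty)
var-[] {Δ = Δ} (cc {Γ = Γ} _ Γ⊢A refl) here (sc {γ = γ} {t = t} _ _ Δ⊢t refl) =
  subst₂ (Δ ⊢_∶_) (sym (Var-[]-≡ (length Γ) t γ)) (sym ([]ty-fresh γ t (⊢ty⇒Ty< Γ⊢A))) Δ⊢t
var-[] {Δ = Δ} (cc Γ⊢ _ refl) (there m) (sc {γ = γ} {t = t} γ∶Γ _ _ refl)
  with ∈⇒scoped Γ⊢ m
... | x< , A< =
  subst₂ (Δ ⊢_∶_) (sym ([]tm-fresh γ t (var< x<))) (sym ([]ty-fresh γ t A<)) (var-[] Γ⊢ m γ∶Γ)

ty-[] : ∀ {Γ Δ γ A} → Γ ⊢ty A → Δ ⊢s γ ∶ Γ → Δ ⊢ty (A [ γ ]ty)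
tm-[] : ∀ {Γ Δ γ t A} → Γ ⊢ t ∶ A → Δ ⊢s γ ∶ Γ → Δ ⊢ (t [ γ ]tm) ∶ (A [ γ ]ty)

ty-[] (ob _)   γ∶Γ = ob (⊢s⇒⊢ γ∶Γ)
ty-[] (ar t u) γ∶Γ = ar (tm-[] t γ∶Γ) (tm-[] u γ∶Γ)

tm-[] (var Γ⊢ m) γ∶Γ = var-[] Γ⊢ m γ∶Γ

mainTheorem2 : (Γ Δ : Ctx) (A : Ty) (t : Tm) (γ : Sub) →
    ((Γ ⊢ty A) → (Δ ⊢s γ ∶ Γ) → (Δ ⊢ty (A [ γ ]ty)))
    × ((Γ ⊢ t ∶ A) → (Δ ⊢s γ ∶ Γ) → (Δ ⊢ (t [ γ ]tm) ∶ (A [ γ ]ty)))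
mainTheorem2 Γ Δ A t γ = ty-[] , tm-[]
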